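{- Let $n$ be a composite integer and $k$ a positive integer. Then $\sum_{j=1}^{n-1} j^{k(n-1)} \equiv -1 \pmod n$ if and only if $n$ is a Giuga Number and $\dfrac{\lambda(n)}{\gcd(\lambda(n),n-1)}$ divides $k$.
   Context: A Giuga Number is a composite integer $n$ such that $p$ divides $n/p-1$ for every prime divisor $p$ of $n$. $\lambda$ is Carmichael's function: $\lambda(n)$ is the smallest positive integer $m$ with $a^m\equiv 1\pmod n$ for all integers $a$ coprime to $n$. -}

module Defs where

open import Data.Nat using (ℕ; zero; suc; _+_; _*_; _∸_; _^_; _<_; _≤_)
open import Data.Nat.Divisibility using (_∣_)
open import Data.Nat.Primality using (Prime; Composite)
open import Data.Nat.Coprimality using (Coprime)
open import Data.Nat.GCD using (gcd)
open import Data.Product using (_×_)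
open import Relation.Binary.PropositionalEquality using (_≡_)

-- ModEq n a b : congruence of naturals a ≡ b (mod n), i.e. n divides |a - b|
ModEq : ℕ → ℕ → ℕ → Set
ModEq n a b = (n ∣ (a ∸ b)) × (n ∣ (b ∸ a))

powSum : ℕ → ℕ → ℕ
powSum zero    e = 0
powSum (suc m) e = powSum m e + suc m ^ e

-- Giuga number: composite n with p ∣ (n/p - 1) for every prime divisor p of n.
-- n/p is written as the cofactor q with n = p * q.
IsGiuga : ℕ → Set
IsGiuga n = Composite n × (∀ p q → Prime p → n ≡ p * q → p ∣ (q ∸ 1))

IsCarmichaelLambda : ℕ → ℕ → Set
IsCarmichaelLambda n L =
  (0 < L)
  × (∀ a → Coprime a n → ModEq n (a ^ L) 1)
  × (∀ m → 0 < m → (∀ a → Coprime a n → ModEq n (a ^ m) 1) → L ≤ m)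

module Submission where

-- Work one prime divisor p of n = p·q at a time.  Since j ↦ j^m is
-- p-periodic modulo p and vanishes at multiples of p, S ≡ q·T (mod p) with
-- T = 1^m + ⋯ + (p-1)^m.  Multiplication by a unit c permutes the nonzero
-- residues, so c^m·T ≡ T; hence either p ∣ T, or c^m ≡ 1 for every unit and
-- then T ≡ p-1 and S + 1 ≡ 1 - q.  So p ∣ S + 1 iff all units satisfy
-- c^m ≡ 1 (mod p) and p ∣ q - 1.  Globally: the Giuga condition makes n
-- squarefree, so congruences modulo the primes p ∣ n glue to one modulo n
-- (and residues mod p lift to units mod n); "c^m ≡ 1 for all units mod n"
-- is λ(n) ∣ m, and λ(n) ∣ k(n-1) is λ(n)/gcd(λ(n), n-1) ∣ k.

open import Defs
open import Data.Fin using (Fin; toℕ; fromℕ<)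
open import Data.Fin.Permutation using (Permutation; permutation)
open import Data.Fin.Properties using (toℕ-fromℕ<; toℕ<n; toℕ-injective)
open import Data.List using ([]; _∷_)
open import Data.List.Relation.Unary.All as All using (All)
open import Data.Nat using (ℕ; zero; suc; pred; _+_; _*_; _∸_; _^_; _<_; _≤_; z≤n; s≤s; s≤s⁻¹;
  NonZero; ≢-nonZero; ≢-nonZero⁻¹; nonTrivial⇒n>1)
open import Data.Nat.Coprimality using (Coprime; coprime-Bézout; coprime-divisor; coprime-/gcd; prime⇒coprime)
  renaming (sym to coprime-sym)
open import Data.Nat.DivMod using (_%_; _/_; m≡m%n+[m/n]*n; [m+kn]%n≡m%n; m%n<n; m<n⇒m%n≡m; m/n*n≡m; m*n/n≡m)
open import Data.Nat.Divisibility
open import Data.Nat.GCD using (gcd; gcd[m,n]∣m; gcd[m,n]∣n; gcd[m,n]≡0⇒m≡0; module Bézout)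
open import Data.Nat.ListAction using (product)
open import Data.Nat.Primality using (Prime; Composite; composite⇒nonZero; composite⇒nonTrivial;
  prime⇒nonTrivial; prime⇒irreducible; euclidsLemma)
open import Data.Nat.Primality.Factorisation using (factorise; PrimeFactorisation)
open import Data.Nat.Properties
open import Algebra.Properties.CommutativeMonoid.Sum +-0-commutativeMonoid
  using (sum; sum-permute; sum-cong-≗)
open import Algebra.Properties.CommutativeSemigroup *-commutativeSemigroup
  using () renaming (interchange to *-interchange)
open import Data.Nat.Tactic.RingSolver using (solve)
open import Data.Product using (∃; ∃₂; _×_; _,_; proj₁; proj₂)
open import Data.Sum using (inj₁; inj₂)
open import Function.Bundles using (_⇔_; mk⇔; Equivalence)
open import Relation.Binary.Bundles using (Setoid)
open import Relation.Binary.PropositionalEquality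
open import Relation.Nullary using (¬_; contradiction)

-- x ≈ y mod d: x and y differ by a multiple of d.  The difference is
-- witnessed additively (x + a d = y + b d) to avoid truncated subtraction.
infix 4 _≈_mod_
_≈_mod_ : ℕ → ℕ → ℕ → Set
_≈_mod_ x y d = ∃₂ λ a b → x + a * d ≡ y + b * d

module _ {d : ℕ} where

  mod-refl : ∀ {x} → x ≈ x mod d
  mod-refl = 0 , 0 , refl

  ≡⇒mod : ∀ {x y} → x ≡ y → x ≈ y mod d
  ≡⇒mod refl = mod-refl

  mod-sym : ∀ {x y} → x ≈ y mod d → y ≈ x mod d
  mod-sym (a , b , e) = b , a , sym e

  mod-trans : ∀ {x y z} → x ≈ y mod d → y ≈ z mod d → x ≈ z mod d
  mod-trans {x} {y} {z} (a , b , x≈y) (c , e , y≈z) = a + c , e + b , (begin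
      x + (a + c) * d      ≡⟨ solve (x ∷ a ∷ c ∷ d ∷ []) ⟩
      (x + a * d) + c * d  ≡⟨ cong (_+ c * d) x≈y ⟩
      (y + b * d) + c * d  ≡⟨ solve (y ∷ b ∷ c ∷ d ∷ []) ⟩
      (y + c * d) + b * d  ≡⟨ cong (_+ b * d) y≈z ⟩
      (z + e * d) + b * d  ≡⟨ solve (z ∷ e ∷ b ∷ d ∷ []) ⟩
      z + (e + b) * d      ∎)
    where open ≡-Reasoning

  mod-+ : ∀ {x y u v} → x ≈ y mod d → u ≈ v mod d → x + u ≈ y + v mod d
  mod-+ {x} {y} {u} {v} (a , b , x≈y) (c , e , u≈v) = a + c , b + e , (begin
      (x + u) + (a + c) * d          ≡⟨ solve (x ∷ u ∷ a ∷ c ∷ d ∷ []) ⟩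
      (x + a * d) + (u + c * d)      ≡⟨ cong₂ _+_ x≈y u≈v ⟩
      (y + b * d) + (v + e * d)      ≡⟨ solve (y ∷ v ∷ b ∷ e ∷ d ∷ []) ⟩
      (y + v) + (b + e) * d          ∎)
    where open ≡-Reasoning

  mod-* : ∀ {x y u v} → x ≈ y mod d → u ≈ v mod d → x * u ≈ y * v mod d
  mod-* {x} {y} {u} {v} (a , b , x≈y) (c , e , u≈v) =
    a * u + x * c + a * c * d , b * v + y * e + b * e * d , (begin
      x * u + (a * u + x * c + a * c * d) * d  ≡⟨ solve (x ∷ u ∷ a ∷ c ∷ d ∷ []) ⟩
      (x + a * d) * (u + c * d)                ≡⟨ cong₂ _*_ x≈y u≈v ⟩
      (y + b * d) * (v + e * d)                ≡⟨ solve (y ∷ v ∷ b ∷ e ∷ d ∷ []) ⟩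
      y * v + (b * v + y * e + b * e * d) * d  ∎)
    where open ≡-Reasoning

  mod-^ : ∀ {x y} e → x ≈ y mod d → x ^ e ≈ y ^ e mod d
  mod-^ zero    x≈y = mod-refl
  mod-^ (suc e) x≈y = mod-* x≈y (mod-^ e x≈y)

  multiple≈0 : ∀ k → k * d ≈ 0 mod d
  multiple≈0 k = 0 , k , +-identityʳ (k * d)

  ∣⇒≈0 : ∀ {x} → d ∣ x → x ≈ 0 mod d
  ∣⇒≈0 (divides k refl) = multiple≈0 k

  ≈0⇒∣ : ∀ {x} → x ≈ 0 mod d → d ∣ x
  ≈0⇒∣ {x} (a , b , e) = ∣m+n∣m⇒∣n (divides b (trans (+-comm (a * d) x) e)) (n∣m*n a)

  ∣∸⇒mod : ∀ {x y} → y ≤ x → d ∣ x ∸ y → x ≈ y mod d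
  ∣∸⇒mod {x} {y} y≤x (divides c e) = 0 , c ,
    trans (+-identityʳ x) (trans (sym (m+[n∸m]≡n y≤x)) (cong (y +_) e))

  mod⇒∣∸ : ∀ {x y} → x ≈ y mod d → d ∣ x ∸ y
  mod⇒∣∸ {x} {y} (a , b , e) = divides (b ∸ a) (begin
      x ∸ y                    ≡⟨ [m+n]∸[m+o]≡n∸o (a * d) x y ⟨
      a * d + x ∸ (a * d + y)  ≡⟨ cong₂ _∸_ (trans (+-comm (a * d) x) e) (+-comm (a * d) y) ⟩
      y + b * d ∸ (y + a * d)  ≡⟨ [m+n]∸[m+o]≡n∸o y (b * d) (a * d) ⟩
      b * d ∸ a * d            ≡⟨ *-distribʳ-∸ d b a ⟨
      (b ∸ a) * d              ∎)
    where open ≡-Reasoning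

  ModEq⇒mod : ∀ {x y} → ModEq d x y → x ≈ y mod d
  ModEq⇒mod {x} {y} (d∣x∸y , d∣y∸x) with ≤-total y x
  ... | inj₁ y≤x = ∣∸⇒mod y≤x d∣x∸y
  ... | inj₂ x≤y = mod-sym (∣∸⇒mod x≤y d∣y∸x)

  mod⇒ModEq : ∀ {x y} → x ≈ y mod d → ModEq d x y
  mod⇒ModEq x≈y = mod⇒∣∸ x≈y , mod⇒∣∸ (mod-sym x≈y)

  mod-divisor : ∀ {e x y} → e ∣ d → x ≈ y mod d → x ≈ y mod e
  mod-divisor {e} {x} {y} (divides c refl) (a , b , eq) = a * c , b * c , (begin
      x + a * c * e    ≡⟨ cong (x +_) (*-assoc a c e) ⟩
      x + a * (c * e)  ≡⟨ eq ⟩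
      y + b * (c * e)  ≡⟨ cong (y +_) (*-assoc b c e) ⟨
      y + b * c * e    ∎)
    where open ≡-Reasoning

mod-∣ : ∀ {d e x y} → e ∣ d → x ≈ y mod d → e ∣ x → e ∣ y
mod-∣ e∣d x≈y e∣x = ≈0⇒∣ (mod-trans (mod-sym (mod-divisor e∣d x≈y)) (∣⇒≈0 e∣x))

module _ {d : ℕ} .{{_ : NonZero d}} where

  mod⇒%≡ : ∀ {x y} → x ≈ y mod d → x % d ≡ y % d
  mod⇒%≡ {x} {y} (a , b , e) = begin
    x % d              ≡⟨ [m+kn]%n≡m%n x a d ⟨
    (x + a * d) % d    ≡⟨ cong (_% d) e ⟩
    (y + b * d) % d    ≡⟨ [m+kn]%n≡m%n y b d ⟩
    y % d              ∎
    where open ≡-Reasoning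

  %≈ : ∀ x → x % d ≈ x mod d
  %≈ x = x / d , 0 , trans (sym (m≡m%n+[m/n]*n x d)) (sym (+-identityʳ x))

modSetoid : ℕ → Setoid _ _
modSetoid d = record
  { Carrier = ℕ ; _≈_ = λ x y → x ≈ y mod d
  ; isEquivalence = record { refl = mod-refl ; sym = mod-sym ; trans = mod-trans } }

inverse : ∀ d {t} → Coprime d t → ∃ λ u → t * u ≈ 1 mod d
inverse d {t} c with coprime-Bézout c
... | Bézout.-+ x y eq = y , 0 , x , trans (+-identityʳ (t * y)) (trans (*-comm t y) (sym eq))
inverse zero    c | Bézout.+- x y eq = contradiction (trans eq (*-zeroʳ x)) λ ()
inverse (suc D) {t} c | Bézout.+- x y eq = y * D , x , y * t , (begin
    t * (y * D) + x * suc D      ≡⟨ cong (t * (y * D) +_) eq ⟨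
    t * (y * D) + (1 + y * t)    ≡⟨ solve (t ∷ y ∷ D ∷ []) ⟩
    1 + y * t * suc D            ∎)
  where open ≡-Reasoning

mod-cancel-unit : ∀ {d t w x y} → t * w ≈ 1 mod d → x * t ≈ y * t mod d → x ≈ y mod d
mod-cancel-unit {d} {t} {w} {x} {y} tw≈1 xt≈yt = begin
    x            ≡⟨ *-identityʳ x ⟨
    x * 1        ≈⟨ mod-* (mod-refl {x = x}) (mod-sym tw≈1) ⟩
    x * (t * w)  ≡⟨ *-assoc x t w ⟨
    x * t * w    ≈⟨ mod-* xt≈yt (mod-refl {x = w}) ⟩
    y * t * w    ≡⟨ *-assoc y t w ⟩
    y * (t * w)  ≈⟨ mod-* (mod-refl {x = y}) tw≈1 ⟩
    y * 1        ≡⟨ *-identityʳ y ⟩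
    y            ∎
  where open import Relation.Binary.Reasoning.Setoid (modSetoid d)

zero-sum-complement : ∀ {d x y} → x + y ≈ 0 mod d → (x ≈ 0 mod d ⇔ y ≈ 0 mod d)
zero-sum-complement {d} {x} {y} x+y≈0 = mk⇔
  (λ x≈0 → mod-trans (mod-+ (mod-sym x≈0) (mod-refl {x = y})) x+y≈0)
  (λ y≈0 → mod-trans (mod-trans (≡⇒mod (sym (+-identityʳ x))) (mod-+ (mod-refl {x = x}) (mod-sym y≈0))) x+y≈0)

prime>1 : ∀ {p} → Prime p → 1 < p
prime>1 {p} p-prime = nonTrivial⇒n>1 p {{prime⇒nonTrivial p-prime}}

prime∤⇒coprime : ∀ {p c} → Prime p → p ∤ c → Coprime p c
prime∤⇒coprime p-prime p∤c (d∣p , d∣c) with prime⇒irreducible p-prime d∣p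
... | inj₁ d≡1 = d≡1
... | inj₂ refl = contradiction d∣c p∤c

prime∤1 : ∀ {p} → Prime p → p ∤ 1
prime∤1 p-prime p∣1 = <⇒≢ (prime>1 p-prime) (sym (∣1⇒≡1 p∣1))

1≉0 : ∀ {p} → Prime p → ¬ (1 ≈ 0 mod p)
1≉0 p-prime 1≈0 = prime∤1 p-prime (≈0⇒∣ 1≈0)

coprime⇒prime∤ : ∀ {a n p} → Coprime a n → Prime p → p ∣ n → p ∤ a
coprime⇒prime∤ {p = p} a⊥n p-prime p∣n p∣a = prime∤1 p-prime (subst (p ∣_) (a⊥n (p∣a , p∣n)) ∣-refl)

coprime-*-∣ : ∀ {m n x} → Coprime m n → m ∣ x → n ∣ x → m * n ∣ x
coprime-*-∣ {m} {n} m⊥n m∣x (divides k refl) = *-monoˡ-∣ n m∣k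
  where
  m∣k : m ∣ k
  m∣k = coprime-divisor m⊥n (subst (m ∣_) (*-comm k n) m∣x)

SquareFree : ℕ → Set
SquareFree n = ∀ p q → Prime p → n ≡ p * q → p ∤ q

squarefree-cofactor : ∀ m {r} → SquareFree (m * r) → SquareFree r
squarefree-cofactor m {r} sf p q p-prime r≡pq p∣q =
  sf p (q * m) p-prime mr≡p[qm] (∣-trans p∣q (m∣m*n m))
  where
  mr≡p[qm] : m * r ≡ p * (q * m)
  mr≡p[qm] = trans (cong (m *_) r≡pq) (solve (m ∷ p ∷ q ∷ []))

squarefree-∣ : ∀ {n x} .{{_ : NonZero n}} → SquareFree n
             → (∀ p → Prime p → p ∣ n → p ∣ x) → n ∣ x
squarefree-∣ {n} {x} = along-factorisation (factorise n)
  where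
  along : ∀ ps → All Prime ps → SquareFree (product ps)
        → (∀ p → Prime p → p ∣ product ps → p ∣ x) → product ps ∣ x
  along []       _                        _  _     = 1∣ x
  along (p ∷ ps) (p-prime All.∷ ps-prime) sf ps∣x =
    coprime-*-∣ (prime∤⇒coprime p-prime (sf p (product ps) p-prime refl))
      (ps∣x p p-prime (m∣m*n (product ps)))
      (along ps ps-prime (squarefree-cofactor p sf)
        (λ p′ p′-prime p′∣ → ps∣x p′ p′-prime (∣-trans p′∣ (n∣m*n p))))

  along-factorisation : ∀ {m} → PrimeFactorisation m → SquareFree m
                      → (∀ p → Prime p → p ∣ m → p ∣ x) → m ∣ x
  along-factorisation record { factors = ps ; isFactorisation = refl ; factorsPrime = ps-prime } =
    along ps ps-prime

squarefree-mod : ∀ {n x y} .{{_ : NonZero n}} → SquareFree n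
               → (∀ p → Prime p → p ∣ n → x ≈ y mod p) → x ≈ y mod n
squarefree-mod sf local = ModEq⇒mod
  ( squarefree-∣ sf (λ p p-prime p∣n → mod⇒∣∸ (local p p-prime p∣n))
  , squarefree-∣ sf (λ p p-prime p∣n → mod⇒∣∸ (mod-sym (local p p-prime p∣n))))

factor∣ : ∀ {n p q} → n ≡ p * q → p ∣ n
factor∣ {q = q} n≡pq = divides q (trans n≡pq (*-comm _ q))

factor-shape : ∀ {n p q} → Prime p → n ≡ p * q → .{{NonZero n}}
             → ∃₂ λ P Q → p ≡ suc P × q ≡ suc Q
factor-shape {n} {suc P} {suc Q} _       _    = P , Q , refl , refl
factor-shape {n} {zero}          p-prime _    = contradiction (prime>1 p-prime) λ ()
factor-shape {n} {suc P} {zero}  _       n≡p0 = contradiction (trans n≡p0 (*-zeroʳ (suc P))) (≢-nonZero⁻¹ n)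

-- A Giuga number is squarefree: p ∣ q - 1 rules out p ∣ q.
giuga⇒squarefree : ∀ {n} → IsGiuga n → SquareFree n
giuga⇒squarefree {n} (n-composite , giuga) p q p-prime n≡pq p∣q
  with factor-shape p-prime n≡pq {{composite⇒nonZero n-composite}}
... | P , Q , refl , refl =
  prime∤1 p-prime (∣m+n∣m⇒∣n (subst (p ∣_) (+-comm 1 Q) p∣q) (giuga p q p-prime n≡pq))

-- Chinese remainder theorem, in the form needed: for coprime p and q and j
-- coprime to p, some a ≡ j (mod p) with a ≡ 1 (mod q) is coprime to p·q.
unit-lift : ∀ {p q j} → Coprime p q → Coprime j p → ∃ λ a → Coprime a (p * q) × a ≈ j mod p
unit-lift {p} {q} {j} p⊥q j⊥p = a , a⊥pq , a≈j
  where
  q⊥p : Coprime q p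
  q⊥p = coprime-sym p⊥q
  v u a : ℕ
  v = proj₁ (inverse p p⊥q)
  u = proj₁ (inverse q q⊥p)
  a = j * (q * v) + p * u
  a≈j : a ≈ j mod p
  a≈j = begin
    j * (q * v) + p * u  ≈⟨ mod-+ (mod-* (mod-refl {x = j}) (proj₂ (inverse p p⊥q)))
                                  (mod-* (≡⇒mod (sym (*-identityˡ p))) (mod-refl {x = u})) ⟩
    j * 1 + 1 * p * u    ≈⟨ mod-+ (mod-refl {x = j * 1}) (mod-* (multiple≈0 1) (mod-refl {x = u})) ⟩
    j * 1 + 0            ≡⟨ trans (+-identityʳ (j * 1)) (*-identityʳ j) ⟩
    j                    ∎
    where open import Relation.Binary.Reasoning.Setoid (modSetoid p)
  a≈1 : a ≈ 1 mod q
  a≈1 = begin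
    j * (q * v) + p * u  ≡⟨ cong (_+ p * u) (trans (cong (j *_) (*-comm q v)) (sym (*-assoc j v q))) ⟩
    (j * v) * q + p * u  ≈⟨ mod-+ (multiple≈0 (j * v)) (proj₂ (inverse q q⊥p)) ⟩
    1                    ∎
    where open import Relation.Binary.Reasoning.Setoid (modSetoid q)
  a⊥p : Coprime a p
  a⊥p (d∣a , d∣p) = j⊥p (mod-∣ d∣p a≈j d∣a , d∣p)
  -- A common divisor d of a and p·q is coprime to p, so it divides q, and
  -- then also 1 ≡ a (mod q).
  a⊥pq : Coprime a (p * q)
  a⊥pq {d} (d∣a , d∣pq) = ∣1⇒≡1 (mod-∣ d∣q a≈1 d∣a)
    where
    d⊥p : Coprime d p
    d⊥p (e∣d , e∣p) = a⊥p (∣-trans e∣d d∣a , e∣p)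
    d∣q : d ∣ q
    d∣q = coprime-divisor d⊥p d∣pq

sumTo : (ℕ → ℕ) → ℕ → ℕ
sumTo g zero    = 0
sumTo g (suc N) = sumTo g N + g (suc N)

powSum≡sumTo : ∀ N e → powSum N e ≡ sumTo (_^ e) N
powSum≡sumTo zero    e = refl
powSum≡sumTo (suc N) e = cong (_+ suc N ^ e) (powSum≡sumTo N e)

sumTo-split : ∀ g a b → sumTo g (a + b) ≡ sumTo g a + sumTo (λ j → g (a + j)) b
sumTo-split g a zero    = trans (cong (sumTo g) (+-identityʳ a)) (sym (+-identityʳ _))
sumTo-split g a (suc b) = begin
  sumTo g (a + suc b)                                   ≡⟨ cong (sumTo g) (+-suc a b) ⟩
  sumTo g (a + b) + g (suc (a + b))                     ≡⟨ cong₂ _+_ (sumTo-split g a b) (cong g (sym (+-suc a b))) ⟩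
  sumTo g a + sumTo (λ j → g (a + j)) b + g (a + suc b) ≡⟨ +-assoc (sumTo g a) _ _ ⟩
  sumTo g a + (sumTo (λ j → g (a + j)) b + g (a + suc b)) ∎
  where open ≡-Reasoning

sumTo-cong : ∀ {d} g h N → (∀ j → 1 ≤ j → j ≤ N → g j ≈ h j mod d)
           → sumTo g N ≈ sumTo h N mod d
sumTo-cong g h zero    g≈h = mod-refl
sumTo-cong g h (suc N) g≈h =
  mod-+ (sumTo-cong g h N (λ j 1≤j j≤N → g≈h j 1≤j (m≤n⇒m≤1+n j≤N))) (g≈h (suc N) (s≤s z≤n) ≤-refl)

sumTo-const : ∀ c N → sumTo (λ _ → c) N ≡ N * c
sumTo-const c zero    = refl
sumTo-const c (suc N) = trans (cong (_+ c) (sumTo-const c N)) (+-comm (N * c) c)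

sumTo-*ˡ : ∀ c g N → sumTo (λ j → c * g j) N ≡ c * sumTo g N
sumTo-*ˡ c g zero    = sym (*-zeroʳ c)
sumTo-*ˡ c g (suc N) = trans (cong (_+ c * g (suc N)) (sumTo-*ˡ c g N)) (sym (*-distribˡ-+ c _ _))

sumTo-≗ : ∀ {g h} → (∀ j → g j ≡ h j) → ∀ N → sumTo g N ≡ sumTo h N
sumTo-≗ g≗h zero    = refl
sumTo-≗ g≗h (suc N) = cong₂ _+_ (sumTo-≗ g≗h N) (g≗h (suc N))

-- The same sum written over Fin N, where the library's permutation lemmas live.
sumTo-Fin : ∀ g N → sum {N} (λ i → g (suc (toℕ i))) ≡ sumTo g N
sumTo-Fin g zero    = refl
sumTo-Fin g (suc N) = trans (cong (g 1 +_) (sumTo-Fin (λ j → g (suc j)) N)) (sym (first g N))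
  where
  first : ∀ g N → sumTo g (suc N) ≡ g 1 + sumTo (λ j → g (suc j)) N
  first g zero    = +-comm 0 (g 1)
  first g (suc N) = trans (cong (_+ g (suc (suc N))) (first g N)) (+-assoc (g 1) _ _)

-- Multiplication by c with p ∤ c permutes the nonzero residues 1, …, p-1
-- modulo a prime p = suc P.  Residue j is represented by j - 1 : Fin P.
module UnitPermutation {P : ℕ} (p-prime : Prime (suc P)) where

  module Multiplication (u : ℕ) (p∤u : suc P ∤ u) where

    residue : Fin P → ℕ
    residue i = (u * suc (toℕ i)) % suc P

    -- p divides neither u nor a number in 1 … P, so p ∤ u·j by Euclid's lemma.
    residue≢0 : ∀ i → residue i ≢ 0
    residue≢0 i r≡0 with euclidsLemma u (suc (toℕ i)) p-prime (m%n≡0⇒n∣m _ (suc P) r≡0)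
    ... | inj₁ p∣u   = p∤u p∣u
    ... | inj₂ p∣i+1 = <⇒≱ (s≤s (toℕ<n i)) (∣⇒≤ p∣i+1)

    -- Being a nonzero remainder, the residue lies in 1 … P.
    pred-residue<P : ∀ i → pred (residue i) < P
    pred-residue<P i = s≤s⁻¹ (subst (_< suc P) (sym (suc-pred (residue i)))
                                    (m%n<n (u * suc (toℕ i)) (suc P)))
      where instance _ = ≢-nonZero (residue≢0 i)

    mul : Fin P → Fin P
    mul i = fromℕ< (pred-residue<P i)

    mul-residue : ∀ i → suc (toℕ (mul i)) ≡ residue i
    mul-residue i = trans (cong suc (toℕ-fromℕ< (pred-residue<P i))) (suc-pred (residue i))
      where instance _ = ≢-nonZero (residue≢0 i)

  open Multiplication

  mul-inverse : ∀ u v (p∤u : suc P ∤ u) (p∤v : suc P ∤ v) → v * u ≈ 1 mod suc P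
              → ∀ i → mul v p∤v (mul u p∤u i) ≡ i
  mul-inverse u v p∤u p∤v vu≈1 i = toℕ-injective (suc-injective (begin
      suc (toℕ (mul v p∤v (mul u p∤u i)))  ≡⟨ mul-residue v p∤v (mul u p∤u i) ⟩
      (v * suc (toℕ (mul u p∤u i))) % p    ≡⟨ cong (λ w → (v * w) % p) (mul-residue u p∤u i) ⟩
      (v * ((u * j) % p)) % p              ≡⟨ mod⇒%≡ vuj≈j ⟩
      j % p                                ≡⟨ m<n⇒m%n≡m (s≤s (toℕ<n i)) ⟩
      j                                    ∎))
    where
    open ≡-Reasoning
    p j : ℕ
    p = suc P
    j = suc (toℕ i)
    vuj≈j : v * ((u * j) % p) ≈ j mod p
    vuj≈j = mod-trans (mod-* (mod-refl {x = v}) (%≈ (u * j)))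
              (mod-trans (≡⇒mod (sym (*-assoc v u j)))
              (mod-trans (mod-* vu≈1 (mod-refl {x = j})) (≡⇒mod (*-identityˡ j))))

  sum-mul-invariant : ∀ g → (∀ {x y} → x ≈ y mod suc P → g x ≈ g y mod suc P)
                    → ∀ c → suc P ∤ c → sumTo (λ j → g (c * j)) P ≈ sumTo g P mod suc P
  sum-mul-invariant g g-resp c p∤c = begin
      sumTo (λ j → g (c * j)) P                ≈⟨ sumTo-cong _ _ P (λ j _ _ → g-resp (mod-sym (%≈ (c * j)))) ⟩
      sumTo (λ j → g ((c * j) % p)) P          ≡⟨ sumTo-Fin (λ j → g ((c * j) % p)) P ⟨
      sum (λ i → g (residue c p∤c i))          ≡⟨ sum-cong-≗ (λ i → cong g (mul-residue c p∤c i)) ⟨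
      sum (λ i → g (suc (toℕ (mul c p∤c i))))  ≡⟨ sum-permute {P} (λ i → g (suc (toℕ i))) π ⟨
      sum {P} (λ i → g (suc (toℕ i)))          ≡⟨ sumTo-Fin g P ⟩
      sumTo g P                                ∎
    where
    open import Relation.Binary.Reasoning.Setoid (modSetoid (suc P))
    p c⁻¹ : ℕ
    p = suc P
    c⁻¹ = proj₁ (inverse p (prime∤⇒coprime p-prime p∤c))
    cc⁻¹≈1 : c * c⁻¹ ≈ 1 mod p
    cc⁻¹≈1 = proj₂ (inverse p (prime∤⇒coprime p-prime p∤c))
    p∤c⁻¹ : p ∤ c⁻¹
    p∤c⁻¹ p∣c⁻¹ = 1≉0 p-prime (mod-trans (mod-sym cc⁻¹≈1)
                    (mod-trans (mod-* (mod-refl {x = c}) (∣⇒≈0 p∣c⁻¹)) (≡⇒mod (*-zeroʳ c))))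
    π : Permutation P P
    π = permutation (mul c p∤c) (mul c⁻¹ p∤c⁻¹)
          (mul-inverse c⁻¹ c p∤c⁻¹ p∤c cc⁻¹≈1)
          (mul-inverse c c⁻¹ p∤c p∤c⁻¹ (mod-trans (≡⇒mod (*-comm c⁻¹ c)) cc⁻¹≈1))

^-distribʳ-* : ∀ x y e → (x * y) ^ e ≡ x ^ e * y ^ e
^-distribʳ-* x y zero    = refl
^-distribʳ-* x y (suc e) = trans (cong (x * y *_) (^-distribʳ-* x y e))
                                 (*-interchange x y (x ^ e) (y ^ e))

-- If a prime p = suc P does not divide T = 1^e + ⋯ + P^e, then c^e ≡ 1 (mod p)
-- whenever p ∤ c: permuting the residues shows c^e·T ≡ T, and T is a unit.
powerSum-unit⇒ : ∀ {P} e → Prime (suc P) → suc P ∤ sumTo (_^ e) P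
               → ∀ c → suc P ∤ c → c ^ e ≈ 1 mod suc P
powerSum-unit⇒ {P} e p-prime p∤T c p∤c =
  mod-cancel-unit (proj₂ (inverse (suc P) (prime∤⇒coprime p-prime p∤T))) (begin
    c ^ e * T                       ≡⟨ sumTo-*ˡ (c ^ e) (_^ e) P ⟨
    sumTo (λ j → c ^ e * j ^ e) P   ≡⟨ sumTo-≗ (λ j → ^-distribʳ-* c j e) P ⟨
    sumTo (λ j → (c * j) ^ e) P     ≈⟨ UnitPermutation.sum-mul-invariant p-prime (_^ e) (mod-^ e) c p∤c ⟩
    T                               ≡⟨ *-identityˡ T ⟨
    1 * T                           ∎)
  where
  open import Relation.Binary.Reasoning.Setoid (modSetoid (suc P))
  T : ℕ
  T = sumTo (_^ e) P

pow≈0 : ∀ {d x} e → 0 < e → d ∣ x → x ^ e ≈ 0 mod d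
pow≈0 {d} {x} (suc e) _ d∣x = mod-* (∣⇒≈0 d∣x) (mod-refl {x = x ^ e})

sumTo-periodic : ∀ {d} g → (∀ i j → g (i * d + j) ≈ g j mod d)
               → ∀ i → sumTo g (i * d) ≈ i * sumTo g d mod d
sumTo-periodic {d} g periodic zero    = mod-refl
sumTo-periodic {d} g periodic (suc i) = begin
    sumTo g (d + i * d)                                ≡⟨ cong (sumTo g) (+-comm d (i * d)) ⟩
    sumTo g (i * d + d)                                ≡⟨ sumTo-split g (i * d) d ⟩
    sumTo g (i * d) + sumTo (λ j → g (i * d + j)) d    ≈⟨ mod-+ (sumTo-periodic g periodic i)
                                                           (sumTo-cong _ g d (λ j _ _ → periodic i j)) ⟩
    i * sumTo g d + sumTo g d                          ≡⟨ +-comm (i * sumTo g d) (sumTo g d) ⟩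
    suc i * sumTo g d                                  ∎
  where open import Relation.Binary.Reasoning.Setoid (modSetoid d)

powSum-mod-divisor : ∀ {n d q} e → 0 < e → n ≡ d * q → .{{NonZero n}}
                   → powSum (n ∸ 1) e ≈ q * sumTo (_^ e) (d ∸ 1) mod d
powSum-mod-divisor {suc n′} {suc D} {q} e 0<e n≡dq = begin
    powSum n′ e                           ≡⟨ +-identityʳ (powSum n′ e) ⟨
    powSum n′ e + 0                       ≈⟨ mod-+ (mod-refl {x = powSum n′ e}) (mod-sym (pow≈0 e 0<e d∣n)) ⟩
    powSum (suc n′) e                     ≡⟨ powSum≡sumTo (suc n′) e ⟩
    sumTo (_^ e) (suc n′)                 ≡⟨ cong (sumTo (_^ e)) (trans n≡dq (*-comm d q)) ⟩
    sumTo (_^ e) (q * d)                  ≈⟨ sumTo-periodic (_^ e) power-periodic q ⟩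
    q * (sumTo (_^ e) D + d ^ e)          ≈⟨ mod-* (mod-refl {x = q}) (mod-+ (mod-refl {x = T}) (pow≈0 e 0<e ∣-refl)) ⟩
    q * (T + 0)                           ≡⟨ cong (q *_) (+-identityʳ T) ⟩
    q * T                                 ∎
  where
  open import Relation.Binary.Reasoning.Setoid (modSetoid (suc D))
  d T : ℕ
  d = suc D
  T = sumTo (_^ e) D
  d∣n : d ∣ suc n′
  d∣n = divides q (trans n≡dq (*-comm d q))
  power-periodic : ∀ i j → (i * d + j) ^ e ≈ j ^ e mod d
  power-periodic i j = mod-^ e (0 , i , trans (+-identityʳ _) (+-comm (i * d) j))

module AtPrimeDivisor {n P Q m} (p-prime : Prime (suc P)) (n≡pq : n ≡ suc P * suc Q) (0<m : 0 < m) where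

  private
    p q S T : ℕ
    p = suc P
    q = suc Q
    S = powSum (n ∸ 1) m
    T = sumTo (_^ m) P

  S≈qT : S ≈ q * T mod p
  S≈qT = powSum-mod-divisor m 0<m n≡pq {{subst NonZero (sym n≡pq) _}}

  units⇒S+1 : (∀ j → 1 ≤ j → j ≤ P → j ^ m ≈ 1 mod p) → S + 1 ≈ q * P + 1 mod p
  units⇒S+1 units = mod-+ (mod-trans S≈qT (mod-* (mod-refl {x = q}) T≈P)) (mod-refl {x = 1})
    where
    T≈P : T ≈ P mod p
    T≈P = mod-trans (sumTo-cong (_^ m) (λ _ → 1) P units)
                    (≡⇒mod (trans (sumTo-const 1 P) (*-identityʳ P)))

  complement : (q * P + 1) + Q ≈ 0 mod p
  complement = mod-trans (≡⇒mod (qP+1+Q≡qp P Q)) (multiple≈0 q)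
    where
    qP+1+Q≡qp : ∀ P Q → (suc Q * P + 1) + Q ≡ suc Q * suc P
    qP+1+Q≡qp P Q = solve (P ∷ Q ∷ [])

  criterion⇒ : p ∣ S + 1 → (∀ c → p ∤ c → c ^ m ≈ 1 mod p) × p ∣ Q
  criterion⇒ p∣S+1 = units , p∣Q
    where
    -- p ∤ T, for otherwise S + 1 ≡ q·T + 1 ≡ 1.
    p∤T : p ∤ T
    p∤T p∣T = 1≉0 p-prime (begin
      1          ≡⟨ cong (_+ 1) (*-zeroʳ q) ⟨
      q * 0 + 1  ≈⟨ mod-+ (mod-sym (mod-* (mod-refl {x = q}) (∣⇒≈0 p∣T))) (mod-refl {x = 1}) ⟩
      q * T + 1  ≈⟨ mod-+ (mod-sym S≈qT) (mod-refl {x = 1}) ⟩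
      S + 1      ≈⟨ ∣⇒≈0 p∣S+1 ⟩
      0          ∎)
      where open import Relation.Binary.Reasoning.Setoid (modSetoid p)
    units : ∀ c → p ∤ c → c ^ m ≈ 1 mod p
    units = powerSum-unit⇒ m p-prime p∤T
    p∣Q : p ∣ Q
    p∣Q = ≈0⇒∣ (Equivalence.to (zero-sum-complement complement) (begin
      q * P + 1  ≈⟨ mod-sym (units⇒S+1 λ { j@(suc _) _ j≤P → units j (>⇒∤ (s≤s j≤P)) }) ⟩
      S + 1      ≈⟨ ∣⇒≈0 p∣S+1 ⟩
      0          ∎))
      where open import Relation.Binary.Reasoning.Setoid (modSetoid p)

  criterion⇐ : (∀ j → 1 ≤ j → j ≤ P → j ^ m ≈ 1 mod p) → p ∣ Q → p ∣ S + 1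
  criterion⇐ units p∣Q = ≈0⇒∣ (mod-trans (units⇒S+1 units)
                                  (Equivalence.from (zero-sum-complement complement) (∣⇒≈0 p∣Q)))

-- Carmichael's function: λ(n) = L divides m exactly when a^m ≡ 1 (mod n) for
-- every a coprime to n.  (⇐: the remainder r of m by L also satisfies a^r ≡ 1,
-- so r = 0 by minimality of L.)
λ∣⇔ : ∀ {n L} m → IsCarmichaelLambda n L
    → (L ∣ m ⇔ (∀ a → Coprime a n → a ^ m ≈ 1 mod n))
λ∣⇔ {n} {L@(suc _)} m (_ , a^L≡1 , L-least) = mk⇔ L∣m⇒ L∣m⇐
  where
  a^[tL]≈1 : ∀ a t → Coprime a n → a ^ (L * t) ≈ 1 mod n
  a^[tL]≈1 a t a⊥n = mod-trans (≡⇒mod (sym (^-*-assoc a L t)))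
                       (mod-trans (mod-^ t (ModEq⇒mod (a^L≡1 a a⊥n))) (≡⇒mod (^-zeroˡ t)))

  L∣m⇒ : L ∣ m → ∀ a → Coprime a n → a ^ m ≈ 1 mod n
  L∣m⇒ (divides t refl) a a⊥n = mod-trans (≡⇒mod (cong (a ^_) (*-comm t L))) (a^[tL]≈1 a t a⊥n)

  L∣m⇐ : (∀ a → Coprime a n → a ^ m ≈ 1 mod n) → L ∣ m
  L∣m⇐ a^m≈1 with m % L in r≡m%L | m%n<n m L
  ... | zero  | _   = m%n≡0⇒n∣m m L r≡m%L
  ... | suc r | r<L = contradiction (L-least (suc r) (s≤s z≤n) (λ a a⊥n → mod⇒ModEq (a^r≈1 a a⊥n))) (<⇒≱ r<L)
    where
    m≡r+Lt : m ≡ suc r + L * (m / L)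
    m≡r+Lt = trans (m≡m%n+[m/n]*n m L) (cong₂ _+_ r≡m%L (*-comm (m / L) L))
    a^r≈1 : ∀ a → Coprime a n → a ^ suc r ≈ 1 mod n
    a^r≈1 a a⊥n = begin
      a ^ suc r                         ≡⟨ *-identityʳ (a ^ suc r) ⟨
      a ^ suc r * 1                     ≈⟨ mod-* (mod-refl {x = a ^ suc r}) (mod-sym (a^[tL]≈1 a (m / L) a⊥n)) ⟩
      a ^ suc r * a ^ (L * (m / L))     ≡⟨ ^-distribˡ-+-* a (suc r) (L * (m / L)) ⟨
      a ^ (suc r + L * (m / L))         ≡⟨ cong (a ^_) m≡r+Lt ⟨
      a ^ m                             ≈⟨ a^m≈1 a a⊥n ⟩
      1                                 ∎
      where open import Relation.Binary.Reasoning.Setoid (modSetoid n)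

-- For L > 0, L divides k·N exactly when L / gcd(L, N) divides k
-- (L / gcd(L, N) being coprime to N / gcd(L, N)).
∣*⇔/gcd∣ : ∀ {L} N k → 0 < L → (L ∣ k * N ⇔ (∀ q → L ≡ q * gcd L N → q ∣ k))
∣*⇔/gcd∣ {L} N k 0<L = mk⇔ ⇒ ⇐
  where
  g : ℕ
  g = gcd L N
  instance
    g≢0 : NonZero g
    g≢0 = ≢-nonZero (λ g≡0 → <⇒≢ 0<L (sym (gcd[m,n]≡0⇒m≡0 g≡0)))
  L≡[L/g]g : L ≡ L / g * g
  L≡[L/g]g = sym (m/n*n≡m (gcd[m,n]∣m L N))

  ⇒ : L ∣ k * N → ∀ q → L ≡ q * g → q ∣ k
  ⇒ L∣kN q L≡qg = coprime-divisor q⊥N/g (subst (q ∣_) (*-comm k (N / g)) q∣k[N/g])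
    where
    q⊥N/g : Coprime q (N / g)
    q⊥N/g = subst (λ z → Coprime z (N / g)) (trans (cong (_/ g) L≡qg) (m*n/n≡m q g)) (coprime-/gcd L N)
    q∣k[N/g] : q ∣ k * (N / g)
    q∣k[N/g] = *-cancelʳ-∣ g (subst₂ _∣_ L≡qg
                 (trans (cong (k *_) (sym (m/n*n≡m (gcd[m,n]∣n L N)))) (sym (*-assoc k (N / g) g))) L∣kN)

  ⇐ : (∀ q → L ≡ q * g → q ∣ k) → L ∣ k * N
  ⇐ /gcd∣k = subst (_∣ k * N) (sym L≡[L/g]g) (*-pres-∣ (/gcd∣k (L / g) L≡[L/g]g) (gcd[m,n]∣n L N))

ModEq0⇔∣ : ∀ {n x} → ModEq n x 0 ⇔ n ∣ x
ModEq0⇔∣ {n} {x} = mk⇔ proj₁ (λ n∣x → n∣x , subst (n ∣_) (sym (0∸n≡0 x)) (n ∣0))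

module GiugaCriterion {n k L} (n-composite : Composite n) (0<k : 0 < k)
                      (λ-n : IsCarmichaelLambda n L) where

  private
    instance
      n≢0 : NonZero n
      n≢0 = composite⇒nonZero n-composite
    m : ℕ
    m = k * (n ∸ 1)
    S : ℕ
    S = powSum (n ∸ 1) m

    0<m : 0 < m
    0<m = *-mono-≤ 0<k (m<n⇒0<n∸m (nonTrivial⇒n>1 n {{composite⇒nonTrivial n-composite}}))

  -- If n ∣ S + 1, the local criterion at every prime p ∣ n makes n a Giuga number
  -- (hence squarefree) with c^m ≡ 1 (mod p) for all units; gluing gives
  -- a^m ≡ 1 (mod n) for all a coprime to n, i.e. λ(n) ∣ m.
  ∣S+1⇒giuga∧λ∣ : n ∣ S + 1 → IsGiuga n × L ∣ m
  ∣S+1⇒giuga∧λ∣ n∣S+1 = giuga , Equivalence.from (λ∣⇔ m λ-n) units-mod-n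
    where
    local : ∀ p q → Prime p → n ≡ p * q → (∀ c → p ∤ c → c ^ m ≈ 1 mod p) × p ∣ q ∸ 1
    local p q p-prime n≡pq with factor-shape p-prime n≡pq
    ... | P , Q , refl , refl =
      AtPrimeDivisor.criterion⇒ p-prime n≡pq 0<m (∣-trans (factor∣ n≡pq) n∣S+1)
    giuga : IsGiuga n
    giuga = n-composite , λ p q p-prime n≡pq → proj₂ (local p q p-prime n≡pq)
    units-mod-n : ∀ a → Coprime a n → a ^ m ≈ 1 mod n
    units-mod-n a a⊥n = squarefree-mod (giuga⇒squarefree giuga) λ p p-prime p∣n →
      proj₁ (local p _ p-prime (m∣n⇒n≡m*quotient p∣n)) a (coprime⇒prime∤ a⊥n p-prime p∣n)

  -- Conversely, λ(n) ∣ m gives a^m ≡ 1 (mod n) for units a; lifting every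
  -- residue 1 … p-1 to such a unit gives j^m ≡ 1 (mod p), so the local criterion
  -- yields p ∣ S + 1 for each prime p ∣ n, and squarefreeness gives n ∣ S + 1.
  giuga∧λ∣⇒∣S+1 : IsGiuga n → L ∣ m → n ∣ S + 1
  giuga∧λ∣⇒∣S+1 giuga@(_ , giuga-at) L∣m =
    squarefree-∣ sf λ p p-prime p∣n → local p _ p-prime (m∣n⇒n≡m*quotient p∣n)
    where
    sf : SquareFree n
    sf = giuga⇒squarefree giuga
    units-mod-n : ∀ a → Coprime a n → a ^ m ≈ 1 mod n
    units-mod-n = Equivalence.to (λ∣⇔ m λ-n) L∣m
    local : ∀ p q → Prime p → n ≡ p * q → p ∣ S + 1
    local p q p-prime n≡pq with factor-shape p-prime n≡pq
    ... | P , Q , refl , refl =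
      AtPrimeDivisor.criterion⇐ p-prime n≡pq 0<m units (giuga-at p q p-prime n≡pq)
      where
      units : ∀ j → 1 ≤ j → j ≤ P → j ^ m ≈ 1 mod p
      units j@(suc _) _ j<p = via-lift (unit-lift (prime∤⇒coprime p-prime (sf p q p-prime n≡pq))
                                                  (coprime-sym (prime⇒coprime p-prime (s≤s j<p))))
        where
        via-lift : (∃ λ a → Coprime a (p * q) × a ≈ j mod p) → j ^ m ≈ 1 mod p
        via-lift (a , a⊥pq , a≈j) = mod-trans (mod-^ m (mod-sym a≈j))
          (mod-divisor (factor∣ n≡pq) (units-mod-n a (subst (Coprime a) (sym n≡pq) a⊥pq)))

theorem1 : ∀ (n k L : ℕ) → Composite n → 0 < k → IsCarmichaelLambda n L
           → ModEq n (powSum (n ∸ 1) (k * (n ∸ 1)) + 1) 0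
             ⇔ (IsGiuga n × (∀ q → L ≡ q * gcd L (n ∸ 1) → q ∣ k))
theorem1 n k L n-composite 0<k λ-n = mk⇔
  (λ S+1≡0 → let giuga , L∣m = ∣S+1⇒giuga∧λ∣ (Equivalence.to ModEq0⇔∣ S+1≡0)
             in giuga , Equivalence.to (L∣kN⇔ 0<L) L∣m)
  (λ { (giuga , /gcd∣k) → Equivalence.from ModEq0⇔∣
         (giuga∧λ∣⇒∣S+1 giuga (Equivalence.from (L∣kN⇔ 0<L) /gcd∣k)) })
  where
  open GiugaCriterion n-composite 0<k λ-n
  0<L : 0 < L
  0<L = proj₁ λ-n
  L∣kN⇔ : 0 < L → (L ∣ k * (n ∸ 1) ⇔ (∀ q → L ≡ q * gcd L (n ∸ 1) → q ∣ k))
  L∣kN⇔ = ∣*⇔/gcd∣ (n ∸ 1) k
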